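{- Let $L$ be an $n\times n$ M-matrix with integer entries, and let $f\in\mathbb{Z}^n$ with $f\ge 0$. Then $f$ is $z$-superstable if and only if $f$ is the minimizer of $E(g)=\|L^{ -1}g\|_2^2$ over all $g\in\mathbb{Z}^n$ with $g\sim f$ and $g\ge 0$.
   Context: An $n\times n$ real matrix $L$ is a Z-matrix if $L_{ij}\le 0$ for all $i\ne j$. A (non-singular) M-matrix is a Z-matrix $L$ that is invertible with $L^{ -1}$ entrywise non-negative. Configurations are vectors in $\mathbb{Z}^n$. Two configurations satisfy $f\sim g$ if $g-f=Lz$ for some $z\in\mathbb{Z}^n$. Inequalities between vectors are entrywise. A vector $f\in\mathbb{Z}^n$ with $f\ge 0$ is $z$-superstable (with respect to $L$) if for every $z\in\mathbb{Z}^n$ with $z\ge 0$ and $z\ne 0$, there exists an index $i$ with $f_i-(Lz)_i<0$. -}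

module Defs where

open import Data.Nat using (ℕ; zero; suc)
open import Data.Fin using (Fin; zero; suc)
open import Data.Integer as ℤ using (ℤ; +_)
open import Data.Rational as ℚ using (ℚ; 0ℚ; 1ℚ)
open import Data.Product using (Σ; ∃; _×_; _,_)
open import Relation.Binary.PropositionalEquality using (_≡_)
open import Relation.Nullary using (¬_)

Vecℤ : ℕ → Set
Vecℤ n = Fin n → ℤ

Matℤ : ℕ → Set
Matℤ n = Fin n → Fin n → ℤ

Matℚ : ℕ → Set
Matℚ n = Fin n → Fin n → ℚ

∑ℤ : ∀ {n} → (Fin n → ℤ) → ℤ
∑ℤ {zero}  f = + 0
∑ℤ {suc n} f = f zero ℤ.+ ∑ℤ (λ i → f (suc i))

∑ℚ : ∀ {n} → (Fin n → ℚ) → ℚ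
∑ℚ {zero}  f = 0ℚ
∑ℚ {suc n} f = f zero ℚ.+ ∑ℚ (λ i → f (suc i))

toℚ : ℤ → ℚ
toℚ z = z ℚ./ 1

_·_ : ∀ {n} → Matℤ n → Vecℤ n → Vecℤ n
(L · z) i = ∑ℤ (λ j → L i j ℤ.* z j)

_·ℚ_ : ∀ {n} → Matℚ n → Vecℤ n → (Fin n → ℚ)
(N ·ℚ g) i = ∑ℚ (λ j → N i j ℚ.* toℚ (g j))

δ : ∀ {n} → Fin n → Fin n → ℚ
δ zero    zero    = 1ℚ
δ zero    (suc j) = 0ℚ
δ (suc i) zero    = 0ℚ
δ (suc i) (suc j) = δ i j

IsInverse : ∀ {n} → Matℤ n → Matℚ n → Set
IsInverse L N =
  (∀ i k → ∑ℚ (λ j → toℚ (L i j) ℚ.* N j k) ≡ δ i k) ×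
  (∀ i k → ∑ℚ (λ j → N i j ℚ.* toℚ (L j k)) ≡ δ i k)

IsZMatrix : ∀ {n} → Matℤ n → Set
IsZMatrix L = ∀ i j → ¬ (i ≡ j) → L i j ℤ.≤ + 0

IsMMatrix : ∀ {n} → Matℤ n → Set
IsMMatrix L = IsZMatrix L × Σ (Matℚ _) (λ N → IsInverse L N × (∀ i j → 0ℚ ℚ.≤ N i j))

-- the inverse carried by an M-matrix proof (unique, since it is a two-sided inverse)
inv : ∀ {n} {L : Matℤ n} → IsMMatrix L → Matℚ n
inv (_ , N , _) = N

_≤v_ : ∀ {n} → Vecℤ n → Vecℤ n → Set
f ≤v g = ∀ i → f i ℤ.≤ g i

Nonneg : ∀ {n} → Vecℤ n → Set
Nonneg f = ∀ i → + 0 ℤ.≤ f i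

_~[_]_ : ∀ {n} → Vecℤ n → Matℤ n → Vecℤ n → Set
f ~[ L ] g = ∃ λ (z : Vecℤ _) → ∀ i → g i ℤ.- f i ≡ (L · z) i

ZSuperstable : ∀ {n} → Matℤ n → Vecℤ n → Set
ZSuperstable L f =
  Nonneg f ×
  (∀ (z : Vecℤ _) → Nonneg z → ¬ (∀ i → z i ≡ + 0) →
     ∃ λ i → f i ℤ.- (L · z) i ℤ.< + 0)

Energy : ∀ {n} → Matℚ n → Vecℤ n → ℚ
Energy N g = ∑ℚ (λ i → (N ·ℚ g) i ℚ.* (N ·ℚ g) i)

-- f is THE (unique) minimizer of E over {g | g ~ f, g ≥ 0}
IsEnergyMinimizer : ∀ {n} (L : Matℤ n) → Matℚ n → Vecℤ n → Set
IsEnergyMinimizer L N f =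
  ∀ (g : Vecℤ _) → f ~[ L ] g → Nonneg g → ¬ (∀ i → g i ≡ f i) →
    Energy N f ℚ.< Energy N g

-- If g = f + L z then L⁻¹ g = L⁻¹ f + z, and L⁻¹ f ≥ 0 since L⁻¹ ≥ 0 and f ≥ 0.  Hence
-- E(g) > E(f) whenever z ≥ 0, z ≠ 0, while E(g) ≤ E(f) when g = f − L z ≥ 0 with z ≥ 0,
-- because then 0 ≤ L⁻¹ g = L⁻¹ f − z ≤ L⁻¹ f.  For a superstable f every g = f + L z ≥ 0
-- has z ≥ 0: the Z-matrix sign pattern gives f − L z⁻ ≥ 0 for the negative part z⁻ of z,
-- and superstability forces z⁻ = 0.  Conversely, a nonzero z ≥ 0 with f − L z ≥ 0 would
-- give a configuration g = f − L z ≠ f of no larger energy.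
module Submission where

open import Defs
open import Data.Nat as ℕ using (ℕ; zero; suc)
open import Data.Fin as Fin using (Fin; zero; suc)
import Data.Fin.Properties as FinP
open import Data.Integer as ℤ using (ℤ; +_; -[1+_])
import Data.Integer.Properties as ℤP
open import Data.Integer.Solver using (module +-*-Solver)
open import Data.Rational as ℚ using (ℚ; 0ℚ; mkℚ; ↥_; *≤*; *<*)
import Data.Rational.Properties as ℚP
open import Data.Rational.Unnormalised as ℚᵘ using (mkℚᵘ; *≡*)
import Data.Rational.Unnormalised.Properties as ℚᵘP
open import Data.Nat.Coprimality as Coprimality using (Coprime; 1-coprimeTo)
open import Data.Product using (∃; _,_)
open import Data.Sum using (_⊎_; inj₁; inj₂)
open import Data.Empty using (⊥-elim)
open import Function using (_∘_)
open import Function.Bundles using (_⇔_; mk⇔)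
open import Algebra.Bundles using (CommutativeRing)
open import Relation.Nullary using (¬_; yes; no)
open import Relation.Binary.PropositionalEquality
  using (_≡_; refl; sym; trans; cong; cong₂; module ≡-Reasoning)

import Algebra.Properties.Semiring.Sum as SemiringSum

open +-*-Solver

module ℤΣ = SemiringSum ℤP.+-*-semiring
module ℚΣ = SemiringSum (CommutativeRing.semiring ℚP.+-*-commutativeRing)

toℚ≡mkℚ : ∀ a → ∃ λ (c : Coprime ℤ.∣ a ∣ 1) → toℚ a ≡ mkℚ a 0 c
toℚ≡mkℚ a = c , ℚP.↥p/↧p≡p (mkℚ a 0 c)
  where c = Coprimality.sym (1-coprimeTo ℤ.∣ a ∣)

↥-toℚ : ∀ a → ↥ toℚ a ≡ a
↥-toℚ a with toℚ≡mkℚ a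
... | _ , eq = cong ↥_ eq

toℚ-injective : ∀ {a b} → toℚ a ≡ toℚ b → a ≡ b
toℚ-injective {a} {b} eq = trans (sym (↥-toℚ a)) (trans (cong ↥_ eq) (↥-toℚ b))

toℚ-mono-≤ : ∀ {a b} → a ℤ.≤ b → toℚ a ℚ.≤ toℚ b
toℚ-mono-≤ {a} {b} a≤b with toℚ≡mkℚ a | toℚ≡mkℚ b
... | _ , eqa | _ , eqb rewrite eqa | eqb = *≤* (ℤP.*-monoʳ-≤-nonNeg (+ 1) a≤b)

toℚ-mono-< : ∀ {a b} → a ℤ.< b → toℚ a ℚ.< toℚ b
toℚ-mono-< {a} {b} a<b with toℚ≡mkℚ a | toℚ≡mkℚ b
... | _ , eqa | _ , eqb rewrite eqa | eqb = *<* (ℤP.*-monoʳ-<-pos (+ 1) a<b)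

-- toℚ a is definitionally fromℚᵘ (mkℚᵘ a 0), so the homomorphism laws reduce to ℚᵘ.
toℚᵘ-toℚ : ∀ a → ℚ.toℚᵘ (toℚ a) ℚᵘ.≃ mkℚᵘ a 0
toℚᵘ-toℚ a = ℚP.toℚᵘ-fromℚᵘ (mkℚᵘ a 0)

toℚ-+ : ∀ a b → toℚ (a ℤ.+ b) ≡ toℚ a ℚ.+ toℚ b
toℚ-+ a b = ℚP.toℚᵘ-injective (begin
  ℚ.toℚᵘ (toℚ (a ℤ.+ b))                 ≈⟨ toℚᵘ-toℚ (a ℤ.+ b) ⟩
  mkℚᵘ (a ℤ.+ b) 0                       ≈⟨ *≡* (cross-multiplied a b) ⟩
  mkℚᵘ a 0 ℚᵘ.+ mkℚᵘ b 0                 ≈⟨ ℚᵘP.+-cong (toℚᵘ-toℚ a) (toℚᵘ-toℚ b) ⟨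
  ℚ.toℚᵘ (toℚ a) ℚᵘ.+ ℚ.toℚᵘ (toℚ b)     ≈⟨ ℚP.toℚᵘ-homo-+ (toℚ a) (toℚ b) ⟨
  ℚ.toℚᵘ (toℚ a ℚ.+ toℚ b)               ∎)
  where
  open ℚᵘP.≃-Reasoning
  cross-multiplied : ∀ a b → (a ℤ.+ b) ℤ.* + 1 ≡ (a ℤ.* + 1 ℤ.+ b ℤ.* + 1) ℤ.* + 1
  cross-multiplied = solve 2 (λ a b → (a :+ b) :* con (+ 1) := (a :* con (+ 1) :+ b :* con (+ 1)) :* con (+ 1)) refl

toℚ-* : ∀ a b → toℚ (a ℤ.* b) ≡ toℚ a ℚ.* toℚ b
toℚ-* a b = ℚP.toℚᵘ-injective (begin
  ℚ.toℚᵘ (toℚ (a ℤ.* b))                 ≈⟨ toℚᵘ-toℚ (a ℤ.* b) ⟩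
  mkℚᵘ (a ℤ.* b) 0                       ≈⟨ *≡* refl ⟩
  mkℚᵘ a 0 ℚᵘ.* mkℚᵘ b 0                 ≈⟨ ℚᵘP.*-cong (toℚᵘ-toℚ a) (toℚᵘ-toℚ b) ⟨
  ℚ.toℚᵘ (toℚ a) ℚᵘ.* ℚ.toℚᵘ (toℚ b)     ≈⟨ ℚP.toℚᵘ-homo-* (toℚ a) (toℚ b) ⟨
  ℚ.toℚᵘ (toℚ a ℚ.* toℚ b)               ∎)
  where open ℚᵘP.≃-Reasoning

∑ℚ≡sum : ∀ {n} (f : Fin n → ℚ) → ∑ℚ f ≡ ℚΣ.sum f
∑ℚ≡sum {zero}  f = refl
∑ℚ≡sum {suc n} f = cong (f zero ℚ.+_) (∑ℚ≡sum (f ∘ suc))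

∑ℚ-cong : ∀ {n} {f g : Fin n → ℚ} → (∀ i → f i ≡ g i) → ∑ℚ f ≡ ∑ℚ g
∑ℚ-cong {zero}  f≗g = refl
∑ℚ-cong {suc n} f≗g = cong₂ ℚ._+_ (f≗g zero) (∑ℚ-cong (f≗g ∘ suc))

∑ℚ-zero : ∀ n → ∑ℚ {n} (λ _ → 0ℚ) ≡ 0ℚ
∑ℚ-zero n = trans (∑ℚ≡sum {n} (λ _ → 0ℚ)) (ℚΣ.sum-replicate-zero n)

∑ℚ-distrib-+ : ∀ {n} (f g : Fin n → ℚ) → ∑ℚ (λ i → f i ℚ.+ g i) ≡ ∑ℚ f ℚ.+ ∑ℚ g
∑ℚ-distrib-+ f g = begin
  ∑ℚ (λ i → f i ℚ.+ g i)  ≡⟨ ∑ℚ≡sum (λ i → f i ℚ.+ g i) ⟩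
  ℚΣ.sum (λ i → f i ℚ.+ g i) ≡⟨ ℚΣ.∑-distrib-+ f g ⟩
  ℚΣ.sum f ℚ.+ ℚΣ.sum g   ≡⟨ cong₂ ℚ._+_ (∑ℚ≡sum f) (∑ℚ≡sum g) ⟨
  ∑ℚ f ℚ.+ ∑ℚ g           ∎
  where open ≡-Reasoning

*-distribˡ-∑ℚ : ∀ {n} c (f : Fin n → ℚ) → c ℚ.* ∑ℚ f ≡ ∑ℚ (λ i → c ℚ.* f i)
*-distribˡ-∑ℚ c f =
  trans (cong (c ℚ.*_) (∑ℚ≡sum f)) (trans (ℚΣ.*-distribˡ-sum c f) (sym (∑ℚ≡sum (λ i → c ℚ.* f i))))

*-distribʳ-∑ℚ : ∀ {n} c (f : Fin n → ℚ) → ∑ℚ f ℚ.* c ≡ ∑ℚ (λ i → f i ℚ.* c)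
*-distribʳ-∑ℚ c f =
  trans (cong (ℚ._* c) (∑ℚ≡sum f)) (trans (ℚΣ.*-distribʳ-sum c f) (sym (∑ℚ≡sum (λ i → f i ℚ.* c))))

∑ℚ-comm : ∀ {m n} (h : Fin m → Fin n → ℚ) →
          ∑ℚ (λ i → ∑ℚ (λ j → h i j)) ≡ ∑ℚ (λ j → ∑ℚ (λ i → h i j))
∑ℚ-comm h = begin
  ∑ℚ (λ i → ∑ℚ (λ j → h i j))          ≡⟨ ∑ℚ²≡sum² h ⟩
  ℚΣ.sum (λ i → ℚΣ.sum (λ j → h i j))  ≡⟨ ℚΣ.∑-comm h ⟩
  ℚΣ.sum (λ j → ℚΣ.sum (λ i → h i j))  ≡⟨ ∑ℚ²≡sum² (λ j i → h i j) ⟨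
  ∑ℚ (λ j → ∑ℚ (λ i → h i j))          ∎
  where
  open ≡-Reasoning
  ∑ℚ²≡sum² : ∀ {m n} (h : Fin m → Fin n → ℚ) →
             ∑ℚ (λ i → ∑ℚ (λ j → h i j)) ≡ ℚΣ.sum (λ i → ℚΣ.sum (λ j → h i j))
  ∑ℚ²≡sum² h = trans (∑ℚ-cong (∑ℚ≡sum ∘ h)) (∑ℚ≡sum (λ i → ℚΣ.sum (h i)))

∑ℚ-δ : ∀ {n} (i : Fin n) (v : Fin n → ℚ) → ∑ℚ (λ k → δ i k ℚ.* v k) ≡ v i
∑ℚ-δ {suc n} zero v = begin
  ℚ.1ℚ ℚ.* v zero ℚ.+ ∑ℚ (λ k → 0ℚ ℚ.* v (suc k))
    ≡⟨ cong₂ ℚ._+_ (ℚP.*-identityˡ (v zero)) (∑ℚ-cong (ℚP.*-zeroˡ ∘ v ∘ suc)) ⟩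
  v zero ℚ.+ ∑ℚ {n} (λ _ → 0ℚ)
    ≡⟨ cong (v zero ℚ.+_) (∑ℚ-zero n) ⟩
  v zero ℚ.+ 0ℚ
    ≡⟨ ℚP.+-identityʳ (v zero) ⟩
  v zero ∎
  where open ≡-Reasoning
∑ℚ-δ {suc n} (suc i) v =
  trans (cong₂ ℚ._+_ (ℚP.*-zeroˡ (v zero)) (∑ℚ-δ i (v ∘ suc))) (ℚP.+-identityˡ (v (suc i)))

∑ℚ-mono-≤ : ∀ {n} {f g : Fin n → ℚ} → (∀ i → f i ℚ.≤ g i) → ∑ℚ f ℚ.≤ ∑ℚ g
∑ℚ-mono-≤ {zero}  f≤g = ℚP.≤-refl
∑ℚ-mono-≤ {suc n} f≤g = ℚP.+-mono-≤ (f≤g zero) (∑ℚ-mono-≤ (f≤g ∘ suc))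

∑ℚ-mono-< : ∀ {n} {f g : Fin n → ℚ} → (∀ i → f i ℚ.≤ g i) →
            ∀ k → f k ℚ.< g k → ∑ℚ f ℚ.< ∑ℚ g
∑ℚ-mono-< {suc n} f≤g zero    fk<gk = ℚP.+-mono-<-≤ fk<gk (∑ℚ-mono-≤ (f≤g ∘ suc))
∑ℚ-mono-< {suc n} f≤g (suc k) fk<gk = ℚP.+-mono-≤-< (f≤g zero) (∑ℚ-mono-< (f≤g ∘ suc) k fk<gk)

∑ℚ-nonneg : ∀ {n} {f : Fin n → ℚ} → (∀ i → 0ℚ ℚ.≤ f i) → 0ℚ ℚ.≤ ∑ℚ f
∑ℚ-nonneg {n} 0≤f = ℚP.≤-trans (ℚP.≤-reflexive (sym (∑ℚ-zero n))) (∑ℚ-mono-≤ 0≤f)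

∑ℤ≡sum : ∀ {n} (f : Fin n → ℤ) → ∑ℤ f ≡ ℤΣ.sum f
∑ℤ≡sum {zero}  f = refl
∑ℤ≡sum {suc n} f = cong (ℤ._+_ (f zero)) (∑ℤ≡sum (f ∘ suc))

∑ℤ-cong : ∀ {n} {f g : Fin n → ℤ} → (∀ i → f i ≡ g i) → ∑ℤ f ≡ ∑ℤ g
∑ℤ-cong {zero}  f≗g = refl
∑ℤ-cong {suc n} f≗g = cong₂ ℤ._+_ (f≗g zero) (∑ℤ-cong (f≗g ∘ suc))

∑ℤ-distrib-+ : ∀ {n} (f g : Fin n → ℤ) → ∑ℤ (λ i → f i ℤ.+ g i) ≡ ∑ℤ f ℤ.+ ∑ℤ g
∑ℤ-distrib-+ f g = begin
  ∑ℤ (λ i → f i ℤ.+ g i)     ≡⟨ ∑ℤ≡sum (λ i → f i ℤ.+ g i) ⟩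
  ℤΣ.sum (λ i → f i ℤ.+ g i) ≡⟨ ℤΣ.∑-distrib-+ f g ⟩
  ℤΣ.sum f ℤ.+ ℤΣ.sum g      ≡⟨ cong₂ ℤ._+_ (∑ℤ≡sum f) (∑ℤ≡sum g) ⟨
  ∑ℤ f ℤ.+ ∑ℤ g              ∎
  where open ≡-Reasoning

∑ℤ-neg : ∀ {n} (f : Fin n → ℤ) → ∑ℤ (λ i → ℤ.- f i) ≡ ℤ.- ∑ℤ f
∑ℤ-neg {zero}  f = refl
∑ℤ-neg {suc n} f =
  trans (cong (ℤ._+_ (ℤ.- f zero)) (∑ℤ-neg (f ∘ suc))) (sym (ℤP.neg-distrib-+ (f zero) (∑ℤ (f ∘ suc))))

∑ℤ-zero : ∀ n → ∑ℤ {n} (λ _ → + 0) ≡ + 0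
∑ℤ-zero n = trans (∑ℤ≡sum {n} (λ _ → + 0)) (ℤΣ.sum-replicate-zero n)

∑ℤ-nonpos : ∀ {n} {f : Fin n → ℤ} → (∀ i → f i ℤ.≤ + 0) → ∑ℤ f ℤ.≤ + 0
∑ℤ-nonpos {zero}  f≤0 = ℤP.≤-refl
∑ℤ-nonpos {suc n} f≤0 = ℤP.+-mono-≤ (f≤0 zero) (∑ℤ-nonpos (f≤0 ∘ suc))

toℚ-∑ℤ : ∀ {n} (f : Fin n → ℤ) → toℚ (∑ℤ f) ≡ ∑ℚ (toℚ ∘ f)
toℚ-∑ℤ {zero}  f = refl
toℚ-∑ℤ {suc n} f = trans (toℚ-+ (f zero) _) (cong (toℚ (f zero) ℚ.+_) (toℚ-∑ℤ (f ∘ suc)))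

-≡⇒≡+ : ∀ a b {c} → a ℤ.- b ≡ c → a ≡ b ℤ.+ c
-≡⇒≡+ a b a-b≡c = trans (solve 2 (λ a b → a := b :+ (a :- b)) refl a b) (cong (ℤ._+_ b) a-b≡c)

module _ {n : ℕ} (L : Matℤ n) where

  ·-cong : ∀ {u v} → (∀ j → u j ≡ v j) → ∀ i → (L · u) i ≡ (L · v) i
  ·-cong u≗v i = ∑ℤ-cong (cong (L i _ ℤ.*_) ∘ u≗v)

  ·-distrib-+ : ∀ u v i → (L · (λ j → u j ℤ.+ v j)) i ≡ (L · u) i ℤ.+ (L · v) i
  ·-distrib-+ u v i = trans (∑ℤ-cong (λ j → ℤP.*-distribˡ-+ (L i j) (u j) (v j)))
                            (∑ℤ-distrib-+ (λ j → L i j ℤ.* u j) (λ j → L i j ℤ.* v j))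

  ·-neg : ∀ u i → (L · (λ j → ℤ.- u j)) i ≡ ℤ.- (L · u) i
  ·-neg u i = trans (∑ℤ-cong (λ j → sym (ℤP.neg-distribʳ-* (L i j) (u j)))) (∑ℤ-neg (λ j → L i j ℤ.* u j))

  ·-zero : ∀ {z} → (∀ j → z j ≡ + 0) → ∀ i → (L · z) i ≡ + 0
  ·-zero z≗0 i = trans (∑ℤ-cong (λ j → trans (cong (L i j ℤ.*_) (z≗0 j)) (ℤP.*-zeroʳ (L i j)))) (∑ℤ-zero n)

module _ {n : ℕ} (N : Matℚ n) where

  ·ℚ-cong : ∀ {u v} → (∀ j → u j ≡ v j) → ∀ i → (N ·ℚ u) i ≡ (N ·ℚ v) i
  ·ℚ-cong u≗v i = ∑ℚ-cong (cong (λ a → N i _ ℚ.* toℚ a) ∘ u≗v)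

  ·ℚ-distrib-+ : ∀ u v i → (N ·ℚ (λ j → u j ℤ.+ v j)) i ≡ (N ·ℚ u) i ℚ.+ (N ·ℚ v) i
  ·ℚ-distrib-+ u v i =
    trans (∑ℚ-cong entry) (∑ℚ-distrib-+ (λ j → N i j ℚ.* toℚ (u j)) (λ j → N i j ℚ.* toℚ (v j)))
    where
    entry : ∀ j → N i j ℚ.* toℚ (u j ℤ.+ v j) ≡ N i j ℚ.* toℚ (u j) ℚ.+ N i j ℚ.* toℚ (v j)
    entry j = trans (cong (N i j ℚ.*_) (toℚ-+ (u j) (v j))) (ℚP.*-distribˡ-+ (N i j) _ _)

  ·ℚ-nonneg : (∀ i j → 0ℚ ℚ.≤ N i j) → ∀ g → Nonneg g → ∀ i → 0ℚ ℚ.≤ (N ·ℚ g) i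
  ·ℚ-nonneg N≥0 g g≥0 i = ∑ℚ-nonneg entry
    where
    entry : ∀ j → 0ℚ ℚ.≤ N i j ℚ.* toℚ (g j)
    entry j = ℚP.nonNegative⁻¹ _ {{ℚP.nonNeg*nonNeg⇒nonNeg (N i j) {{ℚ.nonNegative (N≥0 i j)}}
                                                         (toℚ (g j)) {{ℚ.nonNegative (toℚ-mono-≤ (g≥0 j))}}}}

LeftInverse : ∀ {n} → Matℤ n → Matℚ n → Set
LeftInverse L N = ∀ i k → ∑ℚ (λ j → N i j ℚ.* toℚ (L j k)) ≡ δ i k

module LeftInverseProperties {n : ℕ} (L : Matℤ n) (N : Matℚ n) (NL≡I : LeftInverse L N) where

  ·ℚ-·-cancel : ∀ z i → (N ·ℚ (L · z)) i ≡ toℚ (z i)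
  ·ℚ-·-cancel z i = begin
    ∑ℚ (λ j → N i j ℚ.* toℚ (∑ℤ (λ k → L j k ℤ.* z k)))
      ≡⟨ ∑ℚ-cong (λ j → cong (N i j ℚ.*_) (toℚ-row j)) ⟩
    ∑ℚ (λ j → N i j ℚ.* ∑ℚ (λ k → toℚ (L j k) ℚ.* toℚ (z k)))
      ≡⟨ ∑ℚ-cong (λ j → *-distribˡ-∑ℚ (N i j) (λ k → toℚ (L j k) ℚ.* toℚ (z k))) ⟩
    ∑ℚ (λ j → ∑ℚ (λ k → N i j ℚ.* (toℚ (L j k) ℚ.* toℚ (z k))))
      ≡⟨ ∑ℚ-comm (λ j k → N i j ℚ.* (toℚ (L j k) ℚ.* toℚ (z k))) ⟩
    ∑ℚ (λ k → ∑ℚ (λ j → N i j ℚ.* (toℚ (L j k) ℚ.* toℚ (z k))))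
      ≡⟨ ∑ℚ-cong (λ k → trans (∑ℚ-cong (λ j → sym (ℚP.*-assoc (N i j) _ _)))
                              (sym (*-distribʳ-∑ℚ (toℚ (z k)) (λ j → N i j ℚ.* toℚ (L j k))))) ⟩
    ∑ℚ (λ k → ∑ℚ (λ j → N i j ℚ.* toℚ (L j k)) ℚ.* toℚ (z k))
      ≡⟨ ∑ℚ-cong (λ k → cong (ℚ._* toℚ (z k)) (NL≡I i k)) ⟩
    ∑ℚ (λ k → δ i k ℚ.* toℚ (z k))
      ≡⟨ ∑ℚ-δ i (toℚ ∘ z) ⟩
    toℚ (z i) ∎
    where
    open ≡-Reasoning
    toℚ-row : ∀ j → toℚ ((L · z) j) ≡ ∑ℚ (λ k → toℚ (L j k) ℚ.* toℚ (z k))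
    toℚ-row j = trans (toℚ-∑ℤ (λ k → L j k ℤ.* z k)) (∑ℚ-cong (λ k → toℚ-* (L j k) (z k)))

  ·-zero⇒zero : ∀ z → (∀ i → (L · z) i ≡ + 0) → ∀ i → z i ≡ + 0
  ·-zero⇒zero z Lz≡0 i = toℚ-injective (begin
    toℚ (z i)                  ≡⟨ ·ℚ-·-cancel z i ⟨
    (N ·ℚ (L · z)) i           ≡⟨ ·ℚ-cong N Lz≡0 i ⟩
    (N ·ℚ (λ _ → + 0)) i       ≡⟨ ∑ℚ-cong (λ j → ℚP.*-zeroʳ (N i j)) ⟩
    ∑ℚ {n} (λ _ → 0ℚ)          ≡⟨ ∑ℚ-zero n ⟩
    0ℚ                         ∎)
    where open ≡-Reasoning

  ·ℚ-shift : ∀ f g z → (∀ i → g i ℤ.- f i ≡ (L · z) i) →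
             ∀ i → (N ·ℚ g) i ≡ (N ·ℚ f) i ℚ.+ toℚ (z i)
  ·ℚ-shift f g z g-f≡Lz i = begin
    (N ·ℚ g) i                                ≡⟨ ·ℚ-cong N (λ j → -≡⇒≡+ (g j) (f j) (g-f≡Lz j)) i ⟩
    (N ·ℚ (λ j → f j ℤ.+ (L · z) j)) i        ≡⟨ ·ℚ-distrib-+ N f (L · z) i ⟩
    (N ·ℚ f) i ℚ.+ (N ·ℚ (L · z)) i           ≡⟨ cong ((N ·ℚ f) i ℚ.+_) (·ℚ-·-cancel z i) ⟩
    (N ·ℚ f) i ℚ.+ toℚ (z i)                  ∎
    where open ≡-Reasoning

_⁺ _⁻ : ℤ → ℤ
(+ k) ⁺     = + k
-[1+ k ] ⁺  = + 0
(+ k) ⁻     = + 0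
-[1+ k ] ⁻  = + suc k

⁺-nonneg : ∀ a → + 0 ℤ.≤ a ⁺
⁺-nonneg (+ k)    = ℤ.+≤+ ℕ.z≤n
⁺-nonneg -[1+ k ] = ℤ.+≤+ ℕ.z≤n

⁻-nonneg : ∀ a → + 0 ℤ.≤ a ⁻
⁻-nonneg (+ k)    = ℤ.+≤+ ℕ.z≤n
⁻-nonneg -[1+ k ] = ℤ.+≤+ ℕ.z≤n

⁺-⁻ : ∀ a → a ≡ a ⁺ ℤ.- a ⁻
⁺-⁻ (+ k)    = sym (ℤP.+-identityʳ (+ k))
⁺-⁻ -[1+ k ] = refl

⁻≡0⇒nonneg : ∀ a → a ⁻ ≡ + 0 → + 0 ℤ.≤ a
⁻≡0⇒nonneg (+ k) _ = ℤ.+≤+ ℕ.z≤n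

·-⁺-⁻ : ∀ {n} (L : Matℤ n) z i → (L · z) i ≡ (L · (_⁺ ∘ z)) i ℤ.- (L · (_⁻ ∘ z)) i
·-⁺-⁻ L z i = begin
  (L · z) i                                         ≡⟨ ·-cong L (⁺-⁻ ∘ z) i ⟩
  (L · (λ j → z j ⁺ ℤ.- z j ⁻)) i                   ≡⟨ ·-distrib-+ L (_⁺ ∘ z) (λ j → ℤ.- z j ⁻) i ⟩
  (L · (_⁺ ∘ z)) i ℤ.+ (L · (λ j → ℤ.- z j ⁻)) i    ≡⟨ cong (ℤ._+_ ((L · (_⁺ ∘ z)) i)) (·-neg L (_⁻ ∘ z) i) ⟩
  (L · (_⁺ ∘ z)) i ℤ.- (L · (_⁻ ∘ z)) i             ∎
  where open ≡-Reasoning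

module _ {n : ℕ} {L : Matℤ n} (isZ : IsZMatrix L) where

  ·-nonpos-off-support : ∀ {v} → Nonneg v → ∀ i → v i ≡ + 0 → (L · v) i ℤ.≤ + 0
  ·-nonpos-off-support {v} v≥0 i vi≡0 = ∑ℤ-nonpos entry
    where
    entry : ∀ j → L i j ℤ.* v j ℤ.≤ + 0
    entry j with i Fin.≟ j
    ... | yes refl = ℤP.≤-reflexive (trans (cong (L i i ℤ.*_) vi≡0) (ℤP.*-zeroʳ (L i i)))
    ... | no i≢j   = ℤP.≤-trans (ℤP.*-monoʳ-≤-nonNeg (v j) {{ℤ.nonNegative (v≥0 j)}} (isZ i j i≢j))
                                (ℤP.≤-reflexive (ℤP.*-zeroˡ (v j)))

  -- On the support of z⁻ the vector z⁺ vanishes, so there L z⁺ ≤ 0 and f + L z ≤ f − L z⁻;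
  -- off that support L z⁻ ≤ 0 ≤ f.
  remainder-⁻-nonneg : ∀ f z → Nonneg f → Nonneg (λ i → f i ℤ.+ (L · z) i) →
                       Nonneg (λ i → f i ℤ.- (L · (_⁻ ∘ z)) i)
  remainder-⁻-nonneg f z f≥0 f+Lz≥0 i with z i in zi≡
  ... | + k = ℤP.i≤j⇒0≤j-i (ℤP.≤-trans Lz⁻≤0 (f≥0 i))
    where Lz⁻≤0 = ·-nonpos-off-support (⁻-nonneg ∘ z) i (cong _⁻ zi≡)
  ... | -[1+ k ] = begin
    + 0                       ≤⟨ f+Lz≥0 i ⟩
    f i ℤ.+ (L · z) i         ≡⟨ cong (ℤ._+_ (f i)) (·-⁺-⁻ L z i) ⟩
    f i ℤ.+ (P ℤ.- M)         ≡⟨ solve 3 (λ f P M → f :+ (P :- M) := P :+ (f :- M)) refl (f i) P M ⟩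
    P ℤ.+ (f i ℤ.- M)         ≤⟨ ℤP.+-monoˡ-≤ (f i ℤ.- M) P≤0 ⟩
    + 0 ℤ.+ (f i ℤ.- M)       ≡⟨ ℤP.+-identityˡ (f i ℤ.- M) ⟩
    f i ℤ.- M                 ∎
    where
    open ℤP.≤-Reasoning
    P M : ℤ
    P = (L · (_⁺ ∘ z)) i
    M = (L · (_⁻ ∘ z)) i
    P≤0 : P ℤ.≤ + 0
    P≤0 = ·-nonpos-off-support (⁺-nonneg ∘ z) i (cong _⁺ zi≡)

superstable-remainder-nonneg⇒zero : ∀ {n} (L : Matℤ n) f z → ZSuperstable L f → Nonneg z →
                                    Nonneg (λ i → f i ℤ.- (L · z) i) → ∀ i → z i ≡ + 0
superstable-remainder-nonneg⇒zero L f z (_ , overdraws) z≥0 r≥0 with FinP.all? (λ i → z i ℤ.≟ + 0)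
... | yes z≡0 = z≡0
... | no z≢0 with overdraws z z≥0 z≢0
...   | i , ri<0 = ⊥-elim (ℤP.<⇒≱ ri<0 (r≥0 i))

nonneg⊎negative-entry : ∀ {n} (v : Vecℤ n) → Nonneg v ⊎ ∃ λ i → v i ℤ.< + 0
nonneg⊎negative-entry v with FinP.any? (λ i → v i ℤ.<? + 0)
... | yes neg = inj₂ neg
... | no ¬neg = inj₁ (λ i → ℤP.≮⇒≥ (λ vi<0 → ¬neg (i , vi<0)))

nonneg-nonzero⇒positive-entry : ∀ {n} (z : Vecℤ n) → Nonneg z → ¬ (∀ i → z i ≡ + 0) →
                                ∃ λ k → + 0 ℤ.< z k
nonneg-nonzero⇒positive-entry {n} z z≥0 z≢0 =
  let k , zk≢0 = FinP.¬∀⟶∃¬ n _ (λ i → z i ℤ.≟ + 0) z≢0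
  in k , ℤP.≤∧≢⇒< (z≥0 k) (zk≢0 ∘ sym)

p≤p+q : ∀ p {q} → 0ℚ ℚ.≤ q → p ℚ.≤ p ℚ.+ q
p≤p+q p 0≤q = ℚP.≤-trans (ℚP.≤-reflexive (sym (ℚP.+-identityʳ p))) (ℚP.+-monoʳ-≤ p 0≤q)

p<p+q : ∀ p {q} → 0ℚ ℚ.< q → p ℚ.< p ℚ.+ q
p<p+q p 0<q = ℚP.≤-<-trans (ℚP.≤-reflexive (sym (ℚP.+-identityʳ p))) (ℚP.+-monoʳ-< p 0<q)

p+q≤p : ∀ p {q} → q ℚ.≤ 0ℚ → p ℚ.+ q ℚ.≤ p
p+q≤p p q≤0 = ℚP.≤-trans (ℚP.+-monoʳ-≤ p q≤0) (ℚP.≤-reflexive (ℚP.+-identityʳ p))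

square-mono-≤ : ∀ {p q} → 0ℚ ℚ.≤ p → p ℚ.≤ q → p ℚ.* p ℚ.≤ q ℚ.* q
square-mono-≤ {p} {q} 0≤p p≤q = ℚP.≤-trans (ℚP.*-monoˡ-≤-nonNeg p {{ℚ.nonNegative 0≤p}} p≤q)
                                            (ℚP.*-monoʳ-≤-nonNeg q {{ℚ.nonNegative (ℚP.≤-trans 0≤p p≤q)}} p≤q)

square-mono-< : ∀ {p q} → 0ℚ ℚ.≤ p → p ℚ.< q → p ℚ.* p ℚ.< q ℚ.* q
square-mono-< {p} {q} 0≤p p<q = ℚP.≤-<-trans (ℚP.*-monoˡ-≤-nonNeg p {{ℚ.nonNegative 0≤p}} (ℚP.<⇒≤ p<q))
                                             (ℚP.*-monoˡ-<-pos q {{ℚ.positive (ℚP.≤-<-trans 0≤p p<q)}} p<q)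

∑ℚ-squares-mono-≤ : ∀ {n} {u v : Fin n → ℚ} → (∀ i → 0ℚ ℚ.≤ u i) → (∀ i → u i ℚ.≤ v i) →
                    ∑ℚ (λ i → u i ℚ.* u i) ℚ.≤ ∑ℚ (λ i → v i ℚ.* v i)
∑ℚ-squares-mono-≤ u≥0 u≤v = ∑ℚ-mono-≤ (λ i → square-mono-≤ (u≥0 i) (u≤v i))

∑ℚ-squares-mono-< : ∀ {n} {u v : Fin n → ℚ} → (∀ i → 0ℚ ℚ.≤ u i) → (∀ i → u i ℚ.≤ v i) →
                    ∀ k → u k ℚ.< v k → ∑ℚ (λ i → u i ℚ.* u i) ℚ.< ∑ℚ (λ i → v i ℚ.* v i)
∑ℚ-squares-mono-< u≥0 u≤v k uk<vk =
  ∑ℚ-mono-< (λ i → square-mono-≤ (u≥0 i) (u≤v i)) k (square-mono-< (u≥0 k) uk<vk)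

module _ {n : ℕ} (L : Matℤ n) (N : Matℚ n) (NL≡I : LeftInverse L N) (N≥0 : ∀ i j → 0ℚ ℚ.≤ N i j)
         (f : Vecℤ n) (f≥0 : Nonneg f) where

  open LeftInverseProperties L N NL≡I

  energyMinimizer⇒superstable : IsEnergyMinimizer L N f → ZSuperstable L f
  energyMinimizer⇒superstable minimal = f≥0 , overdraws
    where
    overdraws : ∀ z → Nonneg z → ¬ (∀ i → z i ≡ + 0) → ∃ λ i → f i ℤ.- (L · z) i ℤ.< + 0
    overdraws z z≥0 z≢0 with nonneg⊎negative-entry (λ i → f i ℤ.- (L · z) i)
    ... | inj₂ negative = negative
    ... | inj₁ g≥0 = ⊥-elim (ℚP.<-irrefl refl (ℚP.<-≤-trans Ef<Eg Eg≤Ef))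
      where
      g : Vecℤ n
      g i = f i ℤ.- (L · z) i
      g-f≡L[-z] : ∀ i → g i ℤ.- f i ≡ (L · (ℤ.-_ ∘ z)) i
      g-f≡L[-z] i = trans (solve 2 (λ f a → (f :- a) :- f := :- a) refl (f i) ((L · z) i)) (sym (·-neg L z i))
      g≢f : ¬ (∀ i → g i ≡ f i)
      g≢f g≡f = z≢0 (·-zero⇒zero z Lz≡0)
        where
        Lz≡0 : ∀ i → (L · z) i ≡ + 0
        Lz≡0 i = trans (solve 2 (λ f a → a := f :- (f :- a)) refl (f i) ((L · z) i))
                       (trans (cong (ℤ._-_ (f i)) (g≡f i)) (ℤP.+-inverseʳ (f i)))
      Ef<Eg : Energy N f ℚ.< Energy N g
      Ef<Eg = minimal g (ℤ.-_ ∘ z , g-f≡L[-z]) g≥0 g≢f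
      Eg≤Ef : Energy N g ℚ.≤ Energy N f
      Eg≤Ef = ∑ℚ-squares-mono-≤ (·ℚ-nonneg N N≥0 g g≥0) λ i → begin
        (N ·ℚ g) i                          ≡⟨ ·ℚ-shift f g (ℤ.-_ ∘ z) g-f≡L[-z] i ⟩
        (N ·ℚ f) i ℚ.+ toℚ (ℤ.- z i)        ≤⟨ p+q≤p ((N ·ℚ f) i) (toℚ-mono-≤ (ℤP.neg-mono-≤ (z≥0 i))) ⟩
        (N ·ℚ f) i                          ∎
        where open ℚP.≤-Reasoning

  superstable⇒energyMinimizer : IsZMatrix L → ZSuperstable L f → IsEnergyMinimizer L N f
  superstable⇒energyMinimizer isZ superstable g (z , g-f≡Lz) g≥0 g≢f =
    let k , 0<zk = nonneg-nonzero⇒positive-entry z z≥0 z≢0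
    in ∑ℚ-squares-mono-< (·ℚ-nonneg N N≥0 f f≥0) Nf≤Ng k (Nf<Ng 0<zk)
    where
    z⁻≡0 : ∀ i → z i ⁻ ≡ + 0
    z⁻≡0 = superstable-remainder-nonneg⇒zero L f (_⁻ ∘ z) superstable (⁻-nonneg ∘ z)
             (remainder-⁻-nonneg isZ f z f≥0 f+Lz≥0)
      where
      f+Lz≥0 : Nonneg (λ i → f i ℤ.+ (L · z) i)
      f+Lz≥0 i = ℤP.≤-trans (g≥0 i) (ℤP.≤-reflexive (-≡⇒≡+ (g i) (f i) (g-f≡Lz i)))
    z≥0 : Nonneg z
    z≥0 i = ⁻≡0⇒nonneg (z i) (z⁻≡0 i)
    z≢0 : ¬ (∀ i → z i ≡ + 0)
    z≢0 z≡0 = g≢f (λ i → ℤP.i-j≡0⇒i≡j (g i) (f i) (trans (g-f≡Lz i) (·-zero L z≡0 i)))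
    open ℚP.≤-Reasoning
    Nf≤Ng : ∀ i → (N ·ℚ f) i ℚ.≤ (N ·ℚ g) i
    Nf≤Ng i = begin
      (N ·ℚ f) i                  ≤⟨ p≤p+q _ (toℚ-mono-≤ (z≥0 i)) ⟩
      (N ·ℚ f) i ℚ.+ toℚ (z i)    ≡⟨ ·ℚ-shift f g z g-f≡Lz i ⟨
      (N ·ℚ g) i                  ∎
    Nf<Ng : ∀ {k} → + 0 ℤ.< z k → (N ·ℚ f) k ℚ.< (N ·ℚ g) k
    Nf<Ng {k} 0<zk = begin-strict
      (N ·ℚ f) k                  <⟨ p<p+q _ (toℚ-mono-< 0<zk) ⟩
      (N ·ℚ f) k ℚ.+ toℚ (z k)    ≡⟨ ·ℚ-shift f g z g-f≡Lz k ⟨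
      (N ·ℚ g) k                  ∎

theorem4p6 : (n : ℕ) (L : Matℤ n) (hM : IsMMatrix L) (f : Vecℤ n) →
    Nonneg f →
    (ZSuperstable L f ⇔ IsEnergyMinimizer L (inv hM) f)
theorem4p6 n L (isZ , N , (_ , NL≡I) , N≥0) f f≥0 =
  mk⇔ (superstable⇒energyMinimizer L N NL≡I N≥0 f f≥0 isZ)
      (energyMinimizer⇒superstable L N NL≡I N≥0 f f≥0)
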